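{- Let $f:\{0,1\}^n\to\{0,1\}$ be a Boolean function and let $f^\star(x)=1-f(1-x_1,\dots,1-x_n)$ be its dual. Then $D^{OR}(f)\ge\log_3(|mon(f^\star)|)$.
   Context: $mon(g)$ is the set of subsets $S\subseteq[n]$ whose coefficient in the unique multilinear real polynomial representing $g$ is nonzero. An OR decision tree is a binary tree whose internal nodes are labeled by functions $\bigvee_{i\in S}x_i$ for arbitrary $S\subseteq[n]$ and whose leaves are labeled $0/1$; it computes $f$ if for every input the path determined by the node values (right on 1, left on 0) ends at a leaf labeled $f(x)$. $D^{OR}(f)$ is the minimum depth of an OR decision tree computing $f$. -}

module Defs where

open import Data.Bool using (Bool; true; false; not; _∨_; if_then_else_)
open import Data.Nat using (ℕ; zero; suc; _⊔_)
open import Data.Vec using (Vec; []; _∷_; map; lookup; zipWith; foldr)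
open import Data.List as List using (List; length; filter; concatMap)
open import Data.Rational using (ℚ; 0ℚ; 1ℚ; _+_; _*_; _≟_)
open import Relation.Nullary using (¬?)

-- Boolean inputs / subsets of [n] are bit vectors (Subset n = Vec Bool n).
BoolFun : ℕ → Set
BoolFun n = Vec Bool n → Bool

dual : ∀ {n} → BoolFun n → BoolFun n
dual f x = not (f (map not x))

allSubsets : ∀ n → List (Vec Bool n)
allSubsets zero = [] List.∷ List.[]
allSubsets (suc n) = concatMap (λ S → (false ∷ S) List.∷ (true ∷ S) List.∷ List.[]) (allSubsets n)

b2q : Bool → ℚ
b2q true = 1ℚ
b2q false = 0ℚ

monomial : ∀ {n} → Vec Bool n → Vec Bool n → ℚ
monomial S x = foldr _ _*_ 1ℚ (zipWith (λ s xi → if s then b2q xi else 1ℚ) S x)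

evalPoly : ∀ {n} → (Vec Bool n → ℚ) → Vec Bool n → ℚ
evalPoly {n} c x = List.foldr _+_ 0ℚ (List.map (λ S → c S * monomial S x) (allSubsets n))

Represents : ∀ {n} → (Vec Bool n → ℚ) → BoolFun n → Set
Represents c g = ∀ x → evalPoly c x ≡ b2q (g x)
  where open import Relation.Binary.PropositionalEquality using (_≡_)

supportSize : ∀ {n} → (Vec Bool n → ℚ) → ℕ
supportSize {n} c = length (filter (λ S → ¬? (c S ≟ 0ℚ)) (allSubsets n))

data ORTree (n : ℕ) : Set where
  leaf : Bool → ORTree n
  node : Vec Bool n → ORTree n → ORTree n → ORTree n   -- query ⋁_{i∈S} x_i; left on 0, right on 1

orQuery : ∀ {n} → Vec Bool n → Vec Bool n → Bool
orQuery S x = foldr _ _∨_ false (zipWith (λ s xi → if s then xi else false) S x)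

evalTree : ∀ {n} → ORTree n → Vec Bool n → Bool
evalTree (leaf b) x = b
evalTree (node S l r) x = if orQuery S x then evalTree r x else evalTree l x

depth : ∀ {n} → ORTree n → ℕ
depth (leaf _) = 0
depth (node _ l r) = suc (depth l ⊔ depth r)

Computes : ∀ {n} → ORTree n → BoolFun n → Set
Computes T f = ∀ x → evalTree T x ≡ f x
  where open import Relation.Binary.PropositionalEquality using (_≡_)

-- Run the OR tree on the complemented input: a query ⋁_{i∈S} is then 0 exactly
-- when the monomial x^S is 1, so the dual of a node with subtrees l, r computes
-- g_r + x^S (g_l - g_r). Multiplying by a monomial (reducing x_i² = x_i) never
-- increases the number of nonzero coefficients and sums are subadditive, so this
-- polynomial has at most 3^depth monomials; by uniqueness of the multilinear
-- representation it is the one representing f*.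
module Submission where

open import Defs
open import Data.Nat using (ℕ; _≤_; _^_)
open import Data.Vec using (Vec)
open import Data.Bool using (Bool)
open import Data.Rational using (ℚ)

open import Algebra.Bundles using (CommutativeMonoid)
import Algebra.Properties.CommutativeSemigroup as CommutativeSemigroupProperties
import Algebra.Properties.Group as GroupProperties
open import Data.Bool using (true; false; not; _∧_; if_then_else_)
open import Data.List as List using (List; filter; concatMap; length)
import Data.List.Properties as List
open import Data.Nat as ℕ using (_⊔_; z≤n; s≤s)
import Data.Nat.Properties as ℕ
open import Data.Rational using (0ℚ; 1ℚ; _+_; _*_; -_; _-_; _≟_)
import Data.Rational.Properties as ℚ
open import Data.Rational.Solver using (module +-*-Solver)
open import Data.Vec using ([]; _∷_; map)
open import Data.Nat.ListAction using (sum)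
open import Function using (_∘_)
open import Relation.Binary.PropositionalEquality using (_≡_; refl; sym; trans; cong; cong₂; module ≡-Reasoning)
open import Relation.Nullary using (¬?; does; yes; no; contradiction)
open import Relation.Unary using (Pred; Decidable)

private variable n : ℕ

module _ {c ℓ} (M : CommutativeMonoid c ℓ) where
  open CommutativeMonoid M
    using (Carrier; _≈_; _∙_; ε; setoid; commutativeSemigroup; ∙-congˡ; assoc; identityˡ)
    renaming (sym to ≈-sym)
  open import Relation.Binary.Reasoning.Setoid setoid
  open CommutativeSemigroupProperties commutativeSemigroup using (interchange)

  private
    Σ : ∀ {a} {A : Set a} → (A → Carrier) → List A → Carrier
    Σ h xs = List.foldr _∙_ ε (List.map h xs)

  foldr-map-∙ : ∀ {a} {A : Set a} (g h : A → Carrier) (xs : List A) →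
                List.foldr _∙_ ε (List.map (λ x → g x ∙ h x) xs) ≈ Σ g xs ∙ Σ h xs
  foldr-map-∙ g h List.[] = ≈-sym (identityˡ ε)
  foldr-map-∙ g h (x List.∷ xs) = begin
    (g x ∙ h x) ∙ List.foldr _∙_ ε (List.map (λ x → g x ∙ h x) xs)
      ≈⟨ ∙-congˡ (foldr-map-∙ g h xs) ⟩
    (g x ∙ h x) ∙ (Σ g xs ∙ Σ h xs)
      ≈⟨ interchange (g x) (h x) (Σ g xs) (Σ h xs) ⟩
    (g x ∙ Σ g xs) ∙ (h x ∙ Σ h xs) ∎

  foldr-concatMap-pair : ∀ {a b} {A : Set a} {B : Set b} (h : B → Carrier) (u v : A → B) (xs : List A) →
                         Σ h (concatMap (λ x → u x List.∷ v x List.∷ List.[]) xs) ≈ Σ (h ∘ u) xs ∙ Σ (h ∘ v) xs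
  foldr-concatMap-pair h u v List.[] = ≈-sym (identityˡ ε)
  foldr-concatMap-pair h u v (x List.∷ xs) = begin
    h (u x) ∙ (h (v x) ∙ Σ h (concatMap (λ x → u x List.∷ v x List.∷ List.[]) xs))
      ≈⟨ ∙-congˡ (∙-congˡ (foldr-concatMap-pair h u v xs)) ⟩
    h (u x) ∙ (h (v x) ∙ (Σ (h ∘ u) xs ∙ Σ (h ∘ v) xs))
      ≈⟨ ≈-sym (assoc (h (u x)) (h (v x)) _) ⟩
    (h (u x) ∙ h (v x)) ∙ (Σ (h ∘ u) xs ∙ Σ (h ∘ v) xs)
      ≈⟨ interchange (h (u x)) (h (v x)) (Σ (h ∘ u) xs) (Σ (h ∘ v) xs) ⟩
    (h (u x) ∙ Σ (h ∘ u) xs) ∙ (h (v x) ∙ Σ (h ∘ v) xs) ∎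

length-filter≡sum : ∀ {a p} {A : Set a} {P : Pred A p} (P? : Decidable P) (xs : List A) →
                    length (filter P? xs) ≡ sum (List.map (λ x → if does (P? x) then 1 else 0) xs)
length-filter≡sum P? List.[] = refl
length-filter≡sum P? (x List.∷ xs) with does (P? x)
... | true  = cong ℕ.suc (length-filter≡sum P? xs)
... | false = length-filter≡sum P? xs

sumℚ : List ℚ → ℚ
sumℚ = List.foldr _+_ 0ℚ

sumℚ-map-cong : ∀ {a} {A : Set a} {g h : A → ℚ} → (∀ x → g x ≡ h x) → ∀ xs → sumℚ (List.map g xs) ≡ sumℚ (List.map h xs)
sumℚ-map-cong g≗h xs = cong sumℚ (List.map-cong g≗h xs)

sumℚ-map-scale : ∀ {a} {A : Set a} (q : ℚ) (h : A → ℚ) (xs : List A) →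
                 sumℚ (List.map (λ x → q * h x) xs) ≡ q * sumℚ (List.map h xs)
sumℚ-map-scale q h List.[] = sym (ℚ.*-zeroʳ q)
sumℚ-map-scale q h (x List.∷ xs) = trans (cong (q * h x +_) (sumℚ-map-scale q h xs))
                                         (sym (ℚ.*-distribˡ-+ q (h x) _))

Coeffs : ℕ → Set
Coeffs n = Vec Bool n → ℚ

-- A polynomial p in (x₀, x) splits as p₀(x) + x₀ · ∂₀p(x).
restrict₀ ∂₀ : Coeffs (ℕ.suc n) → Coeffs n
restrict₀ c S = c (false ∷ S)
∂₀ c S = c (true ∷ S)

0ᶜ : Coeffs n
0ᶜ _ = 0ℚ

infixl 6 _⊕_ _⊖_
infix 8 ⊝_

_⊕_ : Coeffs n → Coeffs n → Coeffs n
(a ⊕ b) S = a S + b S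

⊝_ : Coeffs n → Coeffs n
(⊝ a) S = - a S

_⊖_ : Coeffs n → Coeffs n → Coeffs n
a ⊖ b = a ⊕ ⊝ b

constant : ℚ → Coeffs n
constant k [] = k
constant k (false ∷ S) = constant k S
constant k (true ∷ S) = 0ℚ

_⊆ᵇ_ : Vec Bool n → Vec Bool n → Bool
[] ⊆ᵇ [] = true
(false ∷ S) ⊆ᵇ (_ ∷ x) = S ⊆ᵇ x
(true ∷ S) ⊆ᵇ (b ∷ x) = b ∧ (S ⊆ᵇ x)

-- Multilinear reduction: x₀ · (p₀ + x₀ p₁) = x₀ (p₀ + p₁) since x₀² = x₀.
mulMonomial : Vec Bool n → Coeffs n → Coeffs n
mulMonomial [] a [] = a []
mulMonomial (false ∷ S) a (false ∷ U) = mulMonomial S (restrict₀ a) U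
mulMonomial (false ∷ S) a (true ∷ U) = mulMonomial S (∂₀ a) U
mulMonomial (true ∷ S) a (false ∷ U) = 0ℚ
mulMonomial (true ∷ S) a (true ∷ U) = mulMonomial S (restrict₀ a ⊕ ∂₀ a) U

Σ-subsets : (Vec Bool n → ℚ) → ℚ
Σ-subsets {n} h = sumℚ (List.map h (allSubsets n))

evalPoly-∷ : ∀ (c : Coeffs (ℕ.suc n)) b x →
             evalPoly c (b ∷ x) ≡ evalPoly (restrict₀ c) x + b2q b * evalPoly (∂₀ c) x
evalPoly-∷ {n} c b x = begin
  evalPoly c (b ∷ x)
    ≡⟨ foldr-concatMap-pair ℚ.+-0-commutativeMonoid (λ S → c S * monomial S (b ∷ x)) (false ∷_) (true ∷_) (allSubsets n) ⟩
  Σ-subsets (λ S → c (false ∷ S) * (1ℚ * monomial S x)) + Σ-subsets (λ S → c (true ∷ S) * (b2q b * monomial S x))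
    ≡⟨ cong₂ _+_ (sumℚ-map-cong (λ S → cong (c (false ∷ S) *_) (ℚ.*-identityˡ _)) (allSubsets n))
                 (sumℚ-map-cong (λ S → x∙yz≈y∙xz (c (true ∷ S)) (b2q b) (monomial S x)) (allSubsets n)) ⟩
  evalPoly (restrict₀ c) x + Σ-subsets (λ S → b2q b * (c (true ∷ S) * monomial S x))
    ≡⟨ cong (evalPoly (restrict₀ c) x +_) (sumℚ-map-scale (b2q b) (λ S → c (true ∷ S) * monomial S x) (allSubsets n)) ⟩
  evalPoly (restrict₀ c) x + b2q b * evalPoly (∂₀ c) x ∎
  where
  open ≡-Reasoning
  open CommutativeSemigroupProperties (CommutativeMonoid.commutativeSemigroup ℚ.*-1-commutativeMonoid)
    using (x∙yz≈y∙xz)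

evalPoly-false∷ : ∀ (c : Coeffs (ℕ.suc n)) x → evalPoly c (false ∷ x) ≡ evalPoly (restrict₀ c) x
evalPoly-false∷ c x = trans (evalPoly-∷ c false x)
  (trans (cong (evalPoly (restrict₀ c) x +_) (ℚ.*-zeroˡ (evalPoly (∂₀ c) x))) (ℚ.+-identityʳ _))

evalPoly-true∷ : ∀ (c : Coeffs (ℕ.suc n)) x → evalPoly c (true ∷ x) ≡ evalPoly (restrict₀ c) x + evalPoly (∂₀ c) x
evalPoly-true∷ c x = trans (evalPoly-∷ c true x) (cong (evalPoly (restrict₀ c) x +_) (ℚ.*-identityˡ (evalPoly (∂₀ c) x)))

evalPoly-restrict₀-cong : ∀ {a b : Coeffs (ℕ.suc n)} → (∀ x → evalPoly a x ≡ evalPoly b x) →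
                          ∀ x → evalPoly (restrict₀ a) x ≡ evalPoly (restrict₀ b) x
evalPoly-restrict₀-cong {a = a} {b} eq x =
  trans (sym (evalPoly-false∷ a x)) (trans (eq (false ∷ x)) (evalPoly-false∷ b x))

evalPoly-injective : ∀ {a b : Coeffs n} → (∀ x → evalPoly a x ≡ evalPoly b x) → ∀ S → a S ≡ b S
evalPoly-injective {a = a} {b} eq [] = trans (sym (evalPoly-[] a)) (trans (eq []) (evalPoly-[] b))
  where
  evalPoly-[] : ∀ (c : Coeffs 0) → evalPoly c [] ≡ c []
  evalPoly-[] c = trans (ℚ.+-identityʳ _) (ℚ.*-identityʳ (c []))
evalPoly-injective {a = a} {b} eq (false ∷ S) =
  evalPoly-injective {a = restrict₀ a} {restrict₀ b} (evalPoly-restrict₀-cong {a = a} {b} eq) S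
evalPoly-injective {a = a} {b} eq (true ∷ S) = evalPoly-injective {a = ∂₀ a} {∂₀ b} eq₁ S
  where
  open GroupProperties ℚ.+-0-group using (∙-cancelˡ)
  open ≡-Reasoning
  eq₁ : ∀ x → evalPoly (∂₀ a) x ≡ evalPoly (∂₀ b) x
  eq₁ x = ∙-cancelˡ (evalPoly (restrict₀ a) x) (evalPoly (∂₀ a) x) (evalPoly (∂₀ b) x) (begin
    evalPoly (restrict₀ a) x + evalPoly (∂₀ a) x ≡⟨ sym (evalPoly-true∷ a x) ⟩
    evalPoly a (true ∷ x)                         ≡⟨ eq (true ∷ x) ⟩
    evalPoly b (true ∷ x)                         ≡⟨ evalPoly-true∷ b x ⟩
    evalPoly (restrict₀ b) x + evalPoly (∂₀ b) x  ≡⟨ cong (_+ evalPoly (∂₀ b) x) (sym (evalPoly-restrict₀-cong {a = a} {b} eq x)) ⟩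
    evalPoly (restrict₀ a) x + evalPoly (∂₀ b) x  ∎)

evalPoly-0ᶜ : ∀ (x : Vec Bool n) → evalPoly 0ᶜ x ≡ 0ℚ
evalPoly-0ᶜ {n} x = trans (sumℚ-map-scale 0ℚ (λ S → monomial S x) (allSubsets n))
                          (ℚ.*-zeroˡ (Σ-subsets (λ S → monomial S x)))

evalPoly-⊕ : ∀ (a b : Coeffs n) x → evalPoly (a ⊕ b) x ≡ evalPoly a x + evalPoly b x
evalPoly-⊕ {n} a b x = trans
  (sumℚ-map-cong (λ S → ℚ.*-distribʳ-+ (monomial S x) (a S) (b S)) (allSubsets n))
  (foldr-map-∙ ℚ.+-0-commutativeMonoid (λ S → a S * monomial S x) (λ S → b S * monomial S x) (allSubsets n))

evalPoly-⊝ : ∀ (a : Coeffs n) x → evalPoly (⊝ a) x ≡ - evalPoly a x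
evalPoly-⊝ {n} a x = begin
  Σ-subsets (λ S → - a S * monomial S x)      ≡⟨ sumℚ-map-cong (λ S → -p*q≡-1*[p*q] (a S) (monomial S x)) (allSubsets n) ⟩
  Σ-subsets (λ S → - 1ℚ * (a S * monomial S x)) ≡⟨ sumℚ-map-scale (- 1ℚ) (λ S → a S * monomial S x) (allSubsets n) ⟩
  - 1ℚ * evalPoly a x                           ≡⟨ -1*p≡-p (evalPoly a x) ⟩
  - evalPoly a x                                ∎
  where
  open ≡-Reasoning
  open +-*-Solver
  -p*q≡-1*[p*q] : ∀ p q → - p * q ≡ - 1ℚ * (p * q)
  -p*q≡-1*[p*q] = solve 2 (λ p q → :- p :* q := :- con 1ℚ :* (p :* q)) refl
  -1*p≡-p : ∀ p → - 1ℚ * p ≡ - p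
  -1*p≡-p = solve 1 (λ p → :- con 1ℚ :* p := :- p) refl

evalPoly-⊖ : ∀ (a b : Coeffs n) x → evalPoly (a ⊖ b) x ≡ evalPoly a x - evalPoly b x
evalPoly-⊖ a b x = trans (evalPoly-⊕ a (⊝ b) x) (cong (evalPoly a x +_) (evalPoly-⊝ b x))

evalPoly-constant : ∀ k (x : Vec Bool n) → evalPoly (constant k) x ≡ k
evalPoly-constant k [] = trans (ℚ.+-identityʳ _) (ℚ.*-identityʳ k)
evalPoly-constant k (b ∷ x) = begin
  evalPoly (constant k) (b ∷ x)                                 ≡⟨ evalPoly-∷ (constant k) b x ⟩
  evalPoly (constant k) x + b2q b * evalPoly 0ᶜ x              ≡⟨ cong₂ (λ p q → p + b2q b * q) (evalPoly-constant k x) (evalPoly-0ᶜ x) ⟩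
  k + b2q b * 0ℚ                                                ≡⟨ cong (k +_) (ℚ.*-zeroʳ (b2q b)) ⟩
  k + 0ℚ                                                        ≡⟨ ℚ.+-identityʳ k ⟩
  k                                                             ∎
  where open ≡-Reasoning

evalPoly-mulMonomial : ∀ (S : Vec Bool n) (a : Coeffs n) x →
                       evalPoly (mulMonomial S a) x ≡ b2q (S ⊆ᵇ x) * evalPoly a x
evalPoly-mulMonomial [] a [] = sym (ℚ.*-identityˡ (evalPoly a []))
evalPoly-mulMonomial (false ∷ S) a (b ∷ x) = begin
  evalPoly (mulMonomial (false ∷ S) a) (b ∷ x)
    ≡⟨ evalPoly-∷ (mulMonomial (false ∷ S) a) b x ⟩
  evalPoly (mulMonomial S (restrict₀ a)) x + b2q b * evalPoly (mulMonomial S (∂₀ a)) x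
    ≡⟨ cong₂ (λ p q → p + b2q b * q) (evalPoly-mulMonomial S (restrict₀ a) x) (evalPoly-mulMonomial S (∂₀ a) x) ⟩
  m * evalPoly (restrict₀ a) x + b2q b * (m * evalPoly (∂₀ a) x)
    ≡⟨ factor m (evalPoly (restrict₀ a) x) (b2q b) (evalPoly (∂₀ a) x) ⟩
  m * (evalPoly (restrict₀ a) x + b2q b * evalPoly (∂₀ a) x)
    ≡⟨ cong (m *_) (evalPoly-∷ a b x) ⟨
  m * evalPoly a (b ∷ x) ∎
  where
  open ≡-Reasoning
  m = b2q (S ⊆ᵇ x)
  factor : ∀ s p t q → s * p + t * (s * q) ≡ s * (p + t * q)
  factor = solve 4 (λ s p t q → s :* p :+ t :* (s :* q) := s :* (p :+ t :* q)) refl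
    where open +-*-Solver
evalPoly-mulMonomial (true ∷ S) a (false ∷ x) = begin
  evalPoly (mulMonomial (true ∷ S) a) (false ∷ x) ≡⟨ evalPoly-false∷ (mulMonomial (true ∷ S) a) x ⟩
  evalPoly 0ᶜ x                                   ≡⟨ evalPoly-0ᶜ x ⟩
  0ℚ                                              ≡⟨ ℚ.*-zeroˡ (evalPoly a (false ∷ x)) ⟨
  0ℚ * evalPoly a (false ∷ x)                     ∎
  where open ≡-Reasoning
evalPoly-mulMonomial (true ∷ S) a (true ∷ x) = begin
  evalPoly (mulMonomial (true ∷ S) a) (true ∷ x)
    ≡⟨ evalPoly-true∷ (mulMonomial (true ∷ S) a) x ⟩
  evalPoly 0ᶜ x + evalPoly (mulMonomial S (restrict₀ a ⊕ ∂₀ a)) x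
    ≡⟨ cong₂ _+_ (evalPoly-0ᶜ x) (evalPoly-mulMonomial S (restrict₀ a ⊕ ∂₀ a) x) ⟩
  0ℚ + b2q (S ⊆ᵇ x) * evalPoly (restrict₀ a ⊕ ∂₀ a) x
    ≡⟨ ℚ.+-identityˡ _ ⟩
  b2q (S ⊆ᵇ x) * evalPoly (restrict₀ a ⊕ ∂₀ a) x
    ≡⟨ cong (b2q (S ⊆ᵇ x) *_) (trans (evalPoly-⊕ (restrict₀ a) (∂₀ a) x) (sym (evalPoly-true∷ a x))) ⟩
  b2q (S ⊆ᵇ x) * evalPoly a (true ∷ x) ∎
  where open ≡-Reasoning

indicator≢0 : ℚ → ℕ
indicator≢0 q = if does (¬? (q ≟ 0ℚ)) then 1 else 0

indicator≢0-≤1 : ∀ q → indicator≢0 q ≤ 1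
indicator≢0-≤1 q with q ≟ 0ℚ
... | yes _ = z≤n
... | no _  = s≤s z≤n

indicator≢0-+ : ∀ p q → indicator≢0 (p + q) ≤ indicator≢0 p ℕ.+ indicator≢0 q
indicator≢0-+ p q with p ≟ 0ℚ
... | yes refl = ℕ.≤-reflexive (cong indicator≢0 (ℚ.+-identityˡ q))
... | no _     = ℕ.≤-trans (indicator≢0-≤1 (p + q)) (ℕ.m≤m+n 1 (indicator≢0 q))

indicator≢0-neg : ∀ q → indicator≢0 (- q) ≡ indicator≢0 q
indicator≢0-neg q with q ≟ 0ℚ | - q ≟ 0ℚ
... | yes _ | yes _ = refl
... | no _  | no _  = refl
... | yes refl | no -0≢0 = contradiction refl -0≢0
... | no q≢0 | yes -q≡0 = contradiction (ℚ.neg-injective -q≡0) q≢0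

sparsity : Coeffs n → ℕ
sparsity {ℕ.zero} c = indicator≢0 (c [])
sparsity {ℕ.suc n} c = sparsity (restrict₀ c) ℕ.+ sparsity (∂₀ c)

supportSize≡sparsity : ∀ (c : Coeffs n) → supportSize c ≡ sparsity c
supportSize≡sparsity {n} c = trans (length-filter≡sum (λ S → ¬? (c S ≟ 0ℚ)) (allSubsets n)) (count≡sparsity c)
  where
  count≡sparsity : ∀ {n} (c : Coeffs n) → sum (List.map (indicator≢0 ∘ c) (allSubsets n)) ≡ sparsity c
  count≡sparsity {ℕ.zero} c = ℕ.+-identityʳ (indicator≢0 (c []))
  count≡sparsity {ℕ.suc n} c = trans
    (foldr-concatMap-pair ℕ.+-0-commutativeMonoid (indicator≢0 ∘ c) (false ∷_) (true ∷_) (allSubsets n))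
    (cong₂ ℕ._+_ (count≡sparsity (restrict₀ c)) (count≡sparsity (∂₀ c)))

sparsity-cong : ∀ {a b : Coeffs n} → (∀ S → a S ≡ b S) → sparsity a ≡ sparsity b
sparsity-cong {ℕ.zero} a≗b = cong indicator≢0 (a≗b [])
sparsity-cong {ℕ.suc n} a≗b = cong₂ ℕ._+_ (sparsity-cong (a≗b ∘ (false ∷_))) (sparsity-cong (a≗b ∘ (true ∷_)))

sparsity-0ᶜ : sparsity (0ᶜ {n}) ≡ 0
sparsity-0ᶜ {ℕ.zero} = refl
sparsity-0ᶜ {ℕ.suc n} = cong₂ ℕ._+_ (sparsity-0ᶜ {n}) (sparsity-0ᶜ {n})

sparsity-⊕ : ∀ (a b : Coeffs n) → sparsity (a ⊕ b) ≤ sparsity a ℕ.+ sparsity b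
sparsity-⊕ {ℕ.zero} a b = indicator≢0-+ (a []) (b [])
sparsity-⊕ {ℕ.suc n} a b = begin
  sparsity (restrict₀ a ⊕ restrict₀ b) ℕ.+ sparsity (∂₀ a ⊕ ∂₀ b)
    ≤⟨ ℕ.+-mono-≤ (sparsity-⊕ (restrict₀ a) (restrict₀ b)) (sparsity-⊕ (∂₀ a) (∂₀ b)) ⟩
  (sparsity (restrict₀ a) ℕ.+ sparsity (restrict₀ b)) ℕ.+ (sparsity (∂₀ a) ℕ.+ sparsity (∂₀ b))
    ≡⟨ interchange (sparsity (restrict₀ a)) (sparsity (restrict₀ b)) (sparsity (∂₀ a)) (sparsity (∂₀ b)) ⟩
  sparsity a ℕ.+ sparsity b ∎
  where
  open ℕ.≤-Reasoning
  open CommutativeSemigroupProperties ℕ.+-commutativeSemigroup using (interchange)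

sparsity-⊝ : ∀ (a : Coeffs n) → sparsity (⊝ a) ≡ sparsity a
sparsity-⊝ {ℕ.zero} a = indicator≢0-neg (a [])
sparsity-⊝ {ℕ.suc n} a = cong₂ ℕ._+_ (sparsity-⊝ (restrict₀ a)) (sparsity-⊝ (∂₀ a))

sparsity-⊖ : ∀ (a b : Coeffs n) → sparsity (a ⊖ b) ≤ sparsity a ℕ.+ sparsity b
sparsity-⊖ a b = ℕ.≤-trans (sparsity-⊕ a (⊝ b)) (ℕ.≤-reflexive (cong (sparsity a ℕ.+_) (sparsity-⊝ b)))

sparsity-constant : ∀ k → sparsity (constant {n} k) ≤ 1
sparsity-constant {ℕ.zero} k = indicator≢0-≤1 k
sparsity-constant {ℕ.suc n} k = begin
  sparsity (constant {n} k) ℕ.+ sparsity (0ᶜ {n}) ≡⟨ cong (sparsity (constant {n} k) ℕ.+_) (sparsity-0ᶜ {n}) ⟩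
  sparsity (constant {n} k) ℕ.+ 0                 ≡⟨ ℕ.+-identityʳ _ ⟩
  sparsity (constant {n} k)                       ≤⟨ sparsity-constant {n} k ⟩
  1                                               ∎
  where open ℕ.≤-Reasoning

sparsity-mulMonomial : ∀ (S : Vec Bool n) (a : Coeffs n) → sparsity (mulMonomial S a) ≤ sparsity a
sparsity-mulMonomial [] a = ℕ.≤-refl
sparsity-mulMonomial (false ∷ S) a =
  ℕ.+-mono-≤ (sparsity-mulMonomial S (restrict₀ a)) (sparsity-mulMonomial S (∂₀ a))
sparsity-mulMonomial {ℕ.suc n} (true ∷ S) a = begin
  sparsity (0ᶜ {n}) ℕ.+ sparsity (mulMonomial S (restrict₀ a ⊕ ∂₀ a))
    ≡⟨ cong (ℕ._+ sparsity (mulMonomial S (restrict₀ a ⊕ ∂₀ a))) (sparsity-0ᶜ {n}) ⟩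
  sparsity (mulMonomial S (restrict₀ a ⊕ ∂₀ a))                       ≤⟨ sparsity-mulMonomial S (restrict₀ a ⊕ ∂₀ a) ⟩
  sparsity (restrict₀ a ⊕ ∂₀ a)                                       ≤⟨ sparsity-⊕ (restrict₀ a) (∂₀ a) ⟩
  sparsity a                                                          ∎
  where open ℕ.≤-Reasoning

orQuery-map-not : ∀ (S x : Vec Bool n) → orQuery S (map not x) ≡ not (S ⊆ᵇ x)
orQuery-map-not [] [] = refl
orQuery-map-not (false ∷ S) (_ ∷ x) = orQuery-map-not S x
orQuery-map-not (true ∷ S) (true ∷ x) = orQuery-map-not S x
orQuery-map-not (true ∷ S) (false ∷ x) = refl

dualPoly : ORTree n → Coeffs n
dualPoly (leaf b) = constant (b2q (not b))
dualPoly (node S l r) = dualPoly r ⊕ mulMonomial S (dualPoly l ⊖ dualPoly r)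

dualPoly-represents : ∀ (T : ORTree n) → Represents (dualPoly T) (dual (evalTree T))
dualPoly-represents (leaf b) x = evalPoly-constant (b2q (not b)) x
dualPoly-represents (node S l r) x = begin
  evalPoly (dualPoly r ⊕ mulMonomial S (dualPoly l ⊖ dualPoly r)) x
    ≡⟨ evalPoly-⊕ (dualPoly r) _ x ⟩
  evalPoly (dualPoly r) x + evalPoly (mulMonomial S (dualPoly l ⊖ dualPoly r)) x
    ≡⟨ cong (evalPoly (dualPoly r) x +_) (evalPoly-mulMonomial S _ x) ⟩
  evalPoly (dualPoly r) x + b2q (S ⊆ᵇ x) * evalPoly (dualPoly l ⊖ dualPoly r) x
    ≡⟨ cong (λ q → evalPoly (dualPoly r) x + b2q (S ⊆ᵇ x) * q) (evalPoly-⊖ (dualPoly l) (dualPoly r) x) ⟩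
  evalPoly (dualPoly r) x + b2q (S ⊆ᵇ x) * (evalPoly (dualPoly l) x - evalPoly (dualPoly r) x)
    ≡⟨ cong₂ (λ p q → q + b2q (S ⊆ᵇ x) * (p - q)) (dualPoly-represents l x) (dualPoly-represents r x) ⟩
  gr + b2q (S ⊆ᵇ x) * (gl - gr)
    ≡⟨ select (S ⊆ᵇ x) ⟩
  b2q (not (if not (S ⊆ᵇ x) then evalTree r (map not x) else evalTree l (map not x)))
    ≡⟨ cong (λ q → b2q (not (if q then evalTree r (map not x) else evalTree l (map not x)))) (orQuery-map-not S x) ⟨
  b2q (dual (evalTree (node S l r)) x) ∎
  where
  open ≡-Reasoning
  open +-*-Solver
  gl = b2q (dual (evalTree l) x)
  gr = b2q (dual (evalTree r) x)
  select : ∀ t → gr + b2q t * (gl - gr) ≡ b2q (not (if not t then evalTree r (map not x) else evalTree l (map not x)))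
  select true  = solve 2 (λ p q → q :+ con 1ℚ :* (p :- q) := p) refl gl gr
  select false = solve 2 (λ p q → q :+ con 0ℚ :* (p :- q) := q) refl gl gr

sparsity-dualPoly : ∀ (T : ORTree n) → sparsity (dualPoly T) ≤ 3 ^ depth T
sparsity-dualPoly {n} (leaf b) = sparsity-constant {n} (b2q (not b))
sparsity-dualPoly (node S l r) = begin
  sparsity (dualPoly r ⊕ mulMonomial S (dualPoly l ⊖ dualPoly r))
    ≤⟨ sparsity-⊕ (dualPoly r) _ ⟩
  sparsity (dualPoly r) ℕ.+ sparsity (mulMonomial S (dualPoly l ⊖ dualPoly r))
    ≤⟨ ℕ.+-monoʳ-≤ (sparsity (dualPoly r)) (sparsity-mulMonomial S _) ⟩
  sparsity (dualPoly r) ℕ.+ sparsity (dualPoly l ⊖ dualPoly r)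
    ≤⟨ ℕ.+-monoʳ-≤ (sparsity (dualPoly r)) (sparsity-⊖ (dualPoly l) (dualPoly r)) ⟩
  sparsity (dualPoly r) ℕ.+ (sparsity (dualPoly l) ℕ.+ sparsity (dualPoly r))
    ≤⟨ ℕ.+-mono-≤ (bound r (ℕ.m≤n⊔m (depth l) (depth r)))
                  (ℕ.+-mono-≤ (bound l (ℕ.m≤m⊔n (depth l) (depth r)))
                              (ℕ.≤-trans (bound r (ℕ.m≤n⊔m (depth l) (depth r))) (ℕ.m≤m+n _ 0))) ⟩
  3 ^ d ℕ.+ (3 ^ d ℕ.+ (3 ^ d ℕ.+ 0)) ∎
  where
  open ℕ.≤-Reasoning
  d = depth l ⊔ depth r
  bound : ∀ T → depth T ≤ d → sparsity (dualPoly T) ≤ 3 ^ d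
  bound T dT≤d = ℕ.≤-trans (sparsity-dualPoly T) (ℕ.^-monoʳ-≤ 3 dT≤d)

lemma4p20 : ∀ (n : ℕ) (f : BoolFun n) (c : Vec Bool n → ℚ) →
    Represents c (dual f) →
    ∀ (T : ORTree n) → Computes T f →
    supportSize c ≤ 3 ^ depth T
lemma4p20 n f c c-represents T T-computes = begin
  supportSize c         ≡⟨ supportSize≡sparsity c ⟩
  sparsity c            ≡⟨ sparsity-cong (evalPoly-injective {a = c} {dualPoly T} same-values) ⟩
  sparsity (dualPoly T) ≤⟨ sparsity-dualPoly T ⟩
  3 ^ depth T           ∎
  where
  open ℕ.≤-Reasoning
  same-values : ∀ x → evalPoly c x ≡ evalPoly (dualPoly T) x
  same-values x = trans (c-represents x)
    (trans (cong (b2q ∘ not) (sym (T-computes (map not x)))) (sym (dualPoly-represents T x)))
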